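{- For any positive integer $k$, $$\dim(H_k) = k+1 \text{ and } \mathrm{edim}(H_k) = k + 2^k = n-1,$$ where $n=|V(H_k)|=k+2^k+1$.
   Context: For a positive integer $k$, $F_k$ is the graph on vertex set $A \cup B$, where $B = \{b_1, \ldots, b_k\}$ and $A = \{ a_S \mid S \subseteq B \}$; all pairs of distinct vertices of $B$ are adjacent, all pairs of distinct vertices of $A$ are adjacent, and $b_i\in B$, $a_S\in A$ are adjacent if and only if $b_i \in S$. $H_k = F_k + K_1$, i.e., $F_k$ with one extra vertex $t$ joined to all vertices of $F_k$. $\dim(G)$ is the vertex metric dimension (minimum size of a vertex set distinguishing all pairs of vertices by distances); for an edge $e=xy$ and vertex $v$, $d(e,v)=\min\{d(x,v),d(y,v)\}$, and $\mathrm{edim}(G)$ is the minimum size of a vertex set distinguishing all pairs of edges by such distances. -}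

module Defs where

open import Level using (0ℓ)
open import Data.Nat using (ℕ; zero; suc; _≤_; _⊓_)
open import Data.Fin using (Fin)
open import Data.Fin.Subset using (Subset; _∈_)
open import Data.List using (List; length)
open import Data.List.Membership.Propositional renaming (_∈_ to _∈ₗ_)
open import Data.List.Relation.Unary.Unique.Propositional using (Unique)
open import Data.Product using (Σ; ∃; _×_; _,_)
open import Data.Sum using (_⊎_)
open import Data.Unit using (⊤)
open import Data.Empty using (⊥)
open import Relation.Nullary using (¬_)
open import Relation.Binary.PropositionalEquality using (_≡_; _≢_)

record Graph : Set₁ where
  field
    V   : Set
    Adj : V → V → Set
open Graph public

data Walk (G : Graph) : V G → V G → ℕ → Set where
  here : ∀ {u} → Walk G u u 0
  step : ∀ {u v w n} → Adj G u v → Walk G v w n → Walk G u w (suc n)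

IsDist : (G : Graph) → V G → V G → ℕ → Set
IsDist G u v n = Walk G u v n × (∀ m → Walk G u v m → n ≤ m)

IsEdgeDist : (G : Graph) → V G → V G → V G → ℕ → Set
IsEdgeDist G x y w n =
  Σ ℕ λ dx → Σ ℕ λ dy → IsDist G x w dx × IsDist G y w dy × n ≡ dx ⊓ dy

Resolving : (G : Graph) → List (V G) → Set
Resolving G W =
  ∀ (u v : V G) → u ≢ v →
  Σ (V G) λ w → w ∈ₗ W × Σ ℕ λ du → Σ ℕ λ dv →
    IsDist G u w du × IsDist G v w dv × du ≢ dv

SameEdge : {A : Set} → A → A → A → A → Set
SameEdge x y x' y' = (x ≡ x' × y ≡ y') ⊎ (x ≡ y' × y ≡ x')

EdgeResolving : (G : Graph) → List (V G) → Set
EdgeResolving G W =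
  ∀ (x y x' y' : V G) → Adj G x y → Adj G x' y' → ¬ SameEdge x y x' y' →
  Σ (V G) λ w → w ∈ₗ W × Σ ℕ λ d → Σ ℕ λ d' →
    IsEdgeDist G x y w d × IsEdgeDist G x' y' w d' × d ≢ d'

IsMetricDim : Graph → ℕ → Set
IsMetricDim G d =
  (Σ (List (V G)) λ W → Unique W × length W ≡ d × Resolving G W) ×
  (∀ (W : List (V G)) → Unique W → Resolving G W → d ≤ length W)

IsEdgeMetricDim : Graph → ℕ → Set
IsEdgeMetricDim G d =
  (Σ (List (V G)) λ W → Unique W × length W ≡ d × EdgeResolving G W) ×
  (∀ (W : List (V G)) → Unique W → EdgeResolving G W → d ≤ length W)

-- vertices: t, b_i (i : Fin k), a_S (S ⊆ B, encoded as Subset k)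
data HV (k : ℕ) : Set where
  t : HV k
  b : Fin k → HV k
  a : Subset k → HV k

HAdj : (k : ℕ) → HV k → HV k → Set
HAdj k t     t     = ⊥
HAdj k t     (b _) = ⊤
HAdj k t     (a _) = ⊤
HAdj k (b _) t     = ⊤
HAdj k (a _) t     = ⊤
HAdj k (b i) (b j) = i ≢ j
HAdj k (a S) (a T) = S ≢ T
HAdj k (b i) (a S) = i ∈ S
HAdj k (a S) (b i) = i ∈ S

H : ℕ → Graph
H k = record { V = HV k ; Adj = HAdj k }

module Submission where

-- H_k has a universal vertex t, so it has diameter at most 2: the distance
-- between distinct vertices is 1 or 2 according to adjacency.  In any such
-- graph (module DiameterTwo) three general facts hold.
--  * Metric lower bound: the vertices outside a resolving set W are told
--    apart by their adjacency pattern to W, so |V| ≤ 2^|W| + |W|.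
--  * Edge upper bound: two distinct edges always differ in an endpoint other
--    than any prescribed vertex r (UnorderedPairs), and the endpoint of an
--    edge is the only vertex at edge-distance 0; so V ∖ {r} resolves edges.
--  * Edge lower bound: if the graph has two universal vertices and a third
--    vertex, two vertices p, q outside an edge-resolving set always have a
--    common neighbour c for which the edges cp and cq are at the same
--    distance from every vertex except p and q; hence |V| ≤ 1 + |W|.  For H_k (module Hk) the
-- set {t} ∪ B resolves vertices, t and a_B are universal, and counting the
-- 1 + k + 2^k vertices finishes the proof.

open import Defs
open import Function using (_∘_; id)
open import Data.Nat using (ℕ; zero; suc; _≤_; _+_; _^_; _⊓_; z≤n; s≤s; _≤?_)
open import Data.Nat.Properties
open import Data.Bool using (true; false; if_then_else_) renaming (_≟_ to _≟B_)
open import Data.Fin using (Fin; zero; suc) renaming (_≟_ to _≟F_)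
open import Data.Fin.Subset using (Subset; _∈_; _∉_; ⊤; inside; outside)
open import Data.Fin.Subset.Properties using (_∈?_; ∈⊤; drop-there)
import Data.Vec as Vec
open import Data.Vec using ([]; _∷_)
open import Data.Vec.Properties using (≡-dec; ∷-injectiveʳ)
open import Data.List using (List; []; _∷_; length; map; _++_; filter; allFin)
open import Data.List.Relation.Unary.Any using (here; there; index)
import Data.List.Relation.Unary.All as All
import Data.List.Relation.Unary.All.Properties as All
open import Data.List.Relation.Unary.AllPairs using ([]; _∷_)
open import Data.List.Membership.Propositional using (_─_) renaming (_∈_ to _∈ₗ_; _∉_ to _∉ₗ_)
open import Data.List.Membership.Propositional.Properties
open import Data.List.Relation.Unary.Unique.Propositional using (Unique)
import Data.List.Relation.Unary.Unique.Propositional.Properties as Unique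
open import Data.List.Properties using (length-map; length-++; length-tabulate; length-removeAt′)
open import Data.Product using (Σ; ∃; _×_; _,_; proj₁; proj₂)
import Data.Product as Product
open import Data.Sum using (_⊎_; inj₁; inj₂; [_,_])
import Data.Sum as Sum
open import Data.Unit using (tt)
open import Data.Empty using (⊥; ⊥-elim)
open import Relation.Nullary using (¬_; Dec; yes; no; does; contradiction)
open import Relation.Nullary.Decidable using (¬?; dec-true; dec-false)
open import Relation.Binary.PropositionalEquality using (_≡_; _≢_; refl; sym; trans; cong; cong₂; subst; ≢-sym; module ≡-Reasoning)
open import Relation.Binary.Definitions using (DecidableEquality)

module Counting {A : Set} where

  ∈-─ : ∀ {x z : A} {ys} (x∈ys : x ∈ₗ ys) → z ∈ₗ ys → z ≢ x → z ∈ₗ ys ─ x∈ys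
  ∈-─ (here refl) (here refl) z≢x = ⊥-elim (z≢x refl)
  ∈-─ (here refl) (there z∈ys) _  = z∈ys
  ∈-─ (there _)   (here refl) _   = here refl
  ∈-─ (there x∈ys) (there z∈ys) z≢x = there (∈-─ x∈ys z∈ys z≢x)

  unique-⊆⇒length≤ : ∀ {xs ys : List A} → Unique xs →
    (∀ {z} → z ∈ₗ xs → z ∈ₗ ys) → length xs ≤ length ys
  unique-⊆⇒length≤ {[]} _ _ = z≤n
  unique-⊆⇒length≤ {x ∷ xs} {ys} (x∉xs ∷ xs-unique) xs⊆ys = begin
    suc (length xs)          ≤⟨ s≤s (unique-⊆⇒length≤ xs-unique xs⊆ys─x) ⟩
    suc (length (ys ─ x∈ys)) ≡⟨ length-removeAt′ ys (index x∈ys) ⟨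
    length ys                ∎
    where
    open ≤-Reasoning
    x∈ys : x ∈ₗ ys
    x∈ys = xs⊆ys (here refl)
    xs⊆ys─x : ∀ {z} → z ∈ₗ xs → z ∈ₗ ys ─ x∈ys
    xs⊆ys─x z∈xs = ∈-─ x∈ys (xs⊆ys (there z∈xs)) (≢-sym (All.lookup x∉xs z∈xs))

  unique-map : ∀ {B : Set} (f : A → B) {xs : List A} → Unique xs →
    (∀ {x y} → x ∈ₗ xs → y ∈ₗ xs → x ≢ y → f x ≢ f y) → Unique (map f xs)
  unique-map f [] _ = []
  unique-map f (x∉xs ∷ xs-unique) f-inj =
    All.map⁺ (All.tabulate (λ y∈xs → f-inj (here refl) (there y∈xs) (All.lookup x∉xs y∈xs)))
    ∷ unique-map f xs-unique (λ x∈xs y∈xs → f-inj (there x∈xs) (there y∈xs))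

  unique-subsingleton : ∀ {xs : List A} → Unique xs →
    (∀ {u v} → u ∈ₗ xs → v ∈ₗ xs → u ≢ v → ⊥) → length xs ≤ 1
  unique-subsingleton {[]} _ _ = z≤n
  unique-subsingleton {_ ∷ []} _ _ = s≤s z≤n
  unique-subsingleton {_ ∷ _ ∷ _} (x∉xs ∷ _) distinct =
    ⊥-elim (distinct (here refl) (there (here refl)) (All.head x∉xs))

module Outside {A : Set} (_≟_ : DecidableEquality A) (W : List A) where
  open import Data.List.Membership.DecPropositional _≟_ using () renaming (_∈?_ to _∈ₗ?_)

  outsideOf : List A → List A
  outsideOf = filter (λ v → ¬? (v ∈ₗ? W))

  outsideOf-∉ : ∀ {xs v} → v ∈ₗ outsideOf xs → v ∉ₗ W
  outsideOf-∉ {xs} v∈ = proj₂ (∈-filter⁻ (λ v → ¬? (v ∈ₗ? W)) {xs = xs} v∈)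

  outsideOf-unique : ∀ {xs} → Unique xs → Unique (outsideOf xs)
  outsideOf-unique = Unique.filter⁺ (λ v → ¬? (v ∈ₗ? W))

  length-outsideOf : ∀ {xs} → Unique xs → length xs ≤ length (outsideOf xs) + length W
  length-outsideOf {xs} xs-unique =
    subst (length xs ≤_) (length-++ (outsideOf xs)) (Counting.unique-⊆⇒length≤ xs-unique split)
    where
    split : ∀ {z} → z ∈ₗ xs → z ∈ₗ outsideOf xs ++ W
    split {z} z∈xs with z ∈ₗ? W
    ... | yes z∈W = ∈-++⁺ʳ (outsideOf xs) z∈W
    ... | no z∉W  = ∈-++⁺ˡ (∈-filter⁺ (λ v → ¬? (v ∈ₗ? W)) z∈xs z∉W)

  MissesAtMostOne : Set
  MissesAtMostOne = ∀ {p q} → p ≢ q → p ∉ₗ W → q ∉ₗ W → ⊥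

  missesAtMostOne-bound : ∀ {xs} → Unique xs → MissesAtMostOne → length xs ≤ 1 + length W
  missesAtMostOne-bound {xs} xs-unique misses = begin
    length xs                        ≤⟨ length-outsideOf xs-unique ⟩
    length (outsideOf xs) + length W ≤⟨ +-monoˡ-≤ (length W) outside-at-most-one ⟩
    1 + length W                     ∎
    where
    open ≤-Reasoning
    outside-at-most-one : length (outsideOf xs) ≤ 1
    outside-at-most-one = Counting.unique-subsingleton (outsideOf-unique xs-unique)
      (λ p∈ q∈ p≢q → misses p≢q (outsideOf-∉ {xs} p∈) (outsideOf-∉ {xs} q∈))

allSubsets : (n : ℕ) → List (Subset n)
allSubsets zero    = [] ∷ []
allSubsets (suc n) = map (inside ∷_) (allSubsets n) ++ map (outside ∷_) (allSubsets n)

length-allSubsets : ∀ n → length (allSubsets n) ≡ 2 ^ n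
length-allSubsets zero = refl
length-allSubsets (suc n) = begin
  length (map (inside ∷_) Ss ++ map (outside ∷_) Ss)
    ≡⟨ length-++ (map (inside ∷_) Ss) ⟩
  length (map (inside ∷_) Ss) + length (map (outside ∷_) Ss)
    ≡⟨ cong₂ _+_ (length-map (inside ∷_) Ss) (length-map (outside ∷_) Ss) ⟩
  length Ss + length Ss
    ≡⟨ cong₂ _+_ (length-allSubsets n) (trans (length-allSubsets n) (sym (+-identityʳ (2 ^ n)))) ⟩
  2 ^ n + (2 ^ n + 0) ∎
  where
  open ≡-Reasoning
  Ss = allSubsets n

∈-allSubsets : ∀ {n} (S : Subset n) → S ∈ₗ allSubsets n
∈-allSubsets [] = here refl
∈-allSubsets {suc n} (true ∷ S)  = ∈-++⁺ˡ (∈-map⁺ (inside ∷_) (∈-allSubsets S))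
∈-allSubsets {suc n} (false ∷ S) =
  ∈-++⁺ʳ (map (inside ∷_) (allSubsets n)) (∈-map⁺ (outside ∷_) (∈-allSubsets S))

allSubsets-unique : ∀ n → Unique (allSubsets n)
allSubsets-unique zero = All.[] ∷ []
allSubsets-unique (suc n) =
  Unique.++⁺ (Unique.map⁺ ∷-injectiveʳ (allSubsets-unique n))
             (Unique.map⁺ ∷-injectiveʳ (allSubsets-unique n)) disjoint
  where
  disjoint : ∀ {S} → ¬ (S ∈ₗ map (inside ∷_) (allSubsets n) × S ∈ₗ map (outside ∷_) (allSubsets n))
  disjoint (S∈ᵢ , S∈ₒ) with ∈-map⁻ (inside ∷_) S∈ᵢ | ∈-map⁻ (outside ∷_) S∈ₒ
  ... | _ , _ , refl | _ , _ , ()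

Differ : ∀ {n} → Subset n → Subset n → Set
Differ S T = ∃ λ i → (i ∈ S × i ∉ T) ⊎ (i ∈ T × i ∉ S)

Differ-∷ : ∀ {n x} {S T : Subset n} → Differ S T → Differ (x ∷ S) (x ∷ T)
Differ-∷ {x = x} (i , diff) = suc i , Sum.map lift lift diff
  where
  lift : ∀ {P Q} → i ∈ P × i ∉ Q → suc i ∈ x ∷ P × suc i ∉ x ∷ Q
  lift (i∈P , i∉Q) = Vec.there i∈P , i∉Q ∘ drop-there

subset-difference : ∀ {n} {S T : Subset n} → S ≢ T → Differ S T
subset-difference {S = []} {[]} S≢T = ⊥-elim (S≢T refl)
subset-difference {S = true ∷ S}  {false ∷ T} _ = zero , inj₁ (Vec.here , λ ())
subset-difference {S = false ∷ S} {true ∷ T}  _ = zero , inj₂ (Vec.here , λ ())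
subset-difference {S = true ∷ S}  {true ∷ T}  S≢T = Differ-∷ (subset-difference (S≢T ∘ cong (true ∷_)))
subset-difference {S = false ∷ S} {false ∷ T} S≢T = Differ-∷ (subset-difference (S≢T ∘ cong (false ∷_)))

module UnorderedPairs {A : Set} (_≟_ : DecidableEquality A) where

  InPair : A → A → A → Set
  InPair x y w = w ≡ x ⊎ w ≡ y

  Separates : A → A → A → A → A → Set
  Separates x y x' y' w = (InPair x y w × ¬ InPair x' y' w) ⊎ (InPair x' y' w × ¬ InPair x y w)

  TwoSeparators : A → A → A → A → Set
  TwoSeparators x y x' y' =
    Σ A λ w₁ → Σ A λ w₂ → w₁ ≢ w₂ × Separates x y x' y' w₁ × Separates x y x' y' w₂

  separates-swapˡ : ∀ {x y x' y' w} → Separates y x x' y' w → Separates x y x' y' w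
  separates-swapˡ = Sum.map (Product.map Sum.swap id) (Product.map id (_∘ Sum.swap))

  separates-swapʳ : ∀ {x y x' y' w} → Separates x y y' x' w → Separates x y x' y' w
  separates-swapʳ = Sum.map (Product.map id (_∘ Sum.swap)) (Product.map Sum.swap id)

  swapˡ : ∀ {x y x' y'} → TwoSeparators y x x' y' → TwoSeparators x y x' y'
  swapˡ (w₁ , w₂ , w₁≢w₂ , s₁ , s₂) = w₁ , w₂ , w₁≢w₂ , separates-swapˡ s₁ , separates-swapˡ s₂

  swapʳ : ∀ {x y x' y'} → TwoSeparators x y y' x' → TwoSeparators x y x' y'
  swapʳ (w₁ , w₂ , w₁≢w₂ , s₁ , s₂) = w₁ , w₂ , w₁≢w₂ , separates-swapʳ s₁ , separates-swapʳ s₂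

  shared-endpoint : ∀ {x y y'} → ¬ SameEdge x y x y' → x ≢ y → x ≢ y' → TwoSeparators x y x y'
  shared-endpoint {x} {y} {y'} different x≢y x≢y' =
    y , y' , y≢y' ,
    inj₁ (inj₂ refl , [ x≢y ∘ sym , y≢y' ]) ,
    inj₂ (inj₂ refl , [ x≢y' ∘ sym , y≢y' ∘ sym ])
    where
    y≢y' : y ≢ y'
    y≢y' y≡y' = different (inj₁ (refl , y≡y'))

  separators : ∀ {x y x' y'} → x ≢ y → x' ≢ y' → ¬ SameEdge x y x' y' → TwoSeparators x y x' y'
  separators {x} {y} {x'} {y'} x≢y x'≢y' different with x ≟ x' | x ≟ y' | y ≟ x' | y ≟ y'
  ... | yes refl | _ | _ | _ = shared-endpoint different x≢y x'≢y'
  ... | _ | yes refl | _ | _ =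
    swapʳ (shared-endpoint (different ∘ Sum.swap) x≢y (x'≢y' ∘ sym))
  ... | _ | _ | yes refl | _ =
    swapˡ (shared-endpoint (different ∘ Sum.swap ∘ Sum.map Product.swap Product.swap) (x≢y ∘ sym) x'≢y')
  ... | _ | _ | _ | yes refl =
    swapˡ (swapʳ (shared-endpoint (different ∘ Sum.map Product.swap Product.swap) (x≢y ∘ sym) (x'≢y' ∘ sym)))
  ... | no x≢x' | no x≢y' | no y≢x' | no y≢y' =
    x , y , x≢y , inj₁ (inj₁ refl , [ x≢x' , x≢y' ]) , inj₁ (inj₂ refl , [ y≢x' , y≢y' ])

  separator-avoiding : ∀ {x y x' y'} (r : A) → x ≢ y → x' ≢ y' → ¬ SameEdge x y x' y' →
    Σ A λ w → w ≢ r × Separates x y x' y' w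
  separator-avoiding r x≢y x'≢y' different with separators x≢y x'≢y' different
  ... | w₁ , w₂ , w₁≢w₂ , s₁ , s₂ with w₁ ≟ r
  ...   | no w₁≢r = w₁ , w₁≢r , s₁
  ...   | yes refl = w₂ , w₁≢w₂ ∘ sym , s₂

Universal : (G : Graph) → V G → Set
Universal G z = ∀ w → w ≢ z → Adj G z w

module DiameterTwo
  (G : Graph) (_≟_ : DecidableEquality (V G)) (adj? : ∀ u v → Dec (Adj G u v))
  (irrefl : ∀ {u} → ¬ Adj G u u) (adj-sym : ∀ {u v} → Adj G u v → Adj G v u)
  (hub : V G) (hub-universal : Universal G hub)
  where

  open Outside _≟_
  open UnorderedPairs _≟_

  dist : V G → V G → ℕ
  dist u v with u ≟ v | adj? u v
  ... | yes _ | _     = 0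
  ... | no _  | yes _ = 1
  ... | no _  | no _  = 2

  isDist-dist : ∀ u v → IsDist G u v (dist u v)
  isDist-dist u v with u ≟ v | adj? u v
  ... | yes refl | _ = here , λ _ _ → z≤n
  ... | no u≢v | yes u~v = step u~v here , shortest
    where
    shortest : ∀ m → Walk G u v m → 1 ≤ m
    shortest zero here = ⊥-elim (u≢v refl)
    shortest (suc m) _ = s≤s z≤n
  ... | no u≢v | no u≁v =
    step (adj-sym (hub-universal u u≢hub)) (step (hub-universal v v≢hub) here) , shortest
    where
    u≢hub : u ≢ hub
    u≢hub refl = u≁v (hub-universal v (u≢v ∘ sym))
    v≢hub : v ≢ hub
    v≢hub refl = u≁v (adj-sym (hub-universal u u≢v))
    shortest : ∀ m → Walk G u v m → 2 ≤ m
    shortest zero here = ⊥-elim (u≢v refl)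
    shortest (suc zero) (step u~v here) = ⊥-elim (u≁v u~v)
    shortest (suc (suc m)) _ = s≤s (s≤s z≤n)

  isDist⇒≡dist : ∀ {u v n} → IsDist G u v n → n ≡ dist u v
  isDist⇒≡dist {u} {v} (walk , minimal) =
    ≤-antisym (minimal _ (proj₁ (isDist-dist u v))) (proj₂ (isDist-dist u v) _ walk)

  dist-refl : ∀ u → dist u u ≡ 0
  dist-refl u with u ≟ u
  ... | yes _ = refl
  ... | no u≢u = ⊥-elim (u≢u refl)

  dist-pos : ∀ {u v} → u ≢ v → 1 ≤ dist u v
  dist-pos {u} {v} u≢v with u ≟ v | adj? u v
  ... | yes u≡v | _ = ⊥-elim (u≢v u≡v)
  ... | no _ | yes _ = s≤s z≤n
  ... | no _ | no _  = s≤s z≤n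

  dist-distinct : ∀ {u v} → u ≢ v → dist u v ≡ (if does (adj? u v) then 1 else 2)
  dist-distinct {u} {v} u≢v with u ≟ v | adj? u v
  ... | yes u≡v | _ = ⊥-elim (u≢v u≡v)
  ... | no _ | yes _ = refl
  ... | no _ | no _  = refl

  adj⇒≢ : ∀ {u v} → Adj G u v → u ≢ v
  adj⇒≢ u~v refl = irrefl u~v

  dist-adj : ∀ {u v} → Adj G u v → dist u v ≡ 1
  dist-adj {u} {v} u~v =
    trans (dist-distinct (adj⇒≢ u~v)) (cong (if_then 1 else 2) (dec-true (adj? u v) u~v))

  dist-nonadj : ∀ {u v} → u ≢ v → ¬ Adj G u v → dist u v ≡ 2
  dist-nonadj {u} {v} u≢v u≁v =
    trans (dist-distinct u≢v) (cong (if_then 1 else 2) (dec-false (adj? u v) u≁v))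

  dist-self-separates : ∀ {u v} → u ≢ v → dist u u ≢ dist v u
  dist-self-separates {u} u≢v same =
    n≮0 (subst (1 ≤_) (trans (sym same) (dist-refl u)) (dist-pos (u≢v ∘ sym)))

  resolved-by : ∀ {W u v w} → w ∈ₗ W → dist u w ≢ dist v w →
    Σ (V G) λ w → w ∈ₗ W × Σ ℕ λ du → Σ ℕ λ dv → IsDist G u w du × IsDist G v w dv × du ≢ dv
  resolved-by {u = u} {v} {w} w∈W differ =
    w , w∈W , dist u w , dist v w , isDist-dist u w , isDist-dist v w , differ

  signature : (W : List (V G)) → V G → Subset (length W)
  signature []      u = []
  signature (w ∷ W) u = does (adj? u w) ∷ signature W u

  signature-differs : ∀ {W w u v} → w ∈ₗ W → does (adj? u w) ≢ does (adj? v w) →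
    signature W u ≢ signature W v
  signature-differs (here refl) differ same = differ (cong Vec.head same)
  signature-differs (there w∈W) differ same = signature-differs w∈W differ (cong Vec.tail same)

  resolving⇒signature-injective : ∀ {W} → Resolving G W → ∀ {u v} → u ∉ₗ W → v ∉ₗ W → u ≢ v →
    signature W u ≢ signature W v
  resolving⇒signature-injective {W} resolving {u} {v} u∉W v∉W u≢v
    with resolving u v u≢v
  ... | w , w∈W , du , dv , du-isDist , dv-isDist , du≢dv =
    signature-differs w∈W λ same-adjacency → du≢dv (begin
      du                                         ≡⟨ isDist⇒≡dist du-isDist ⟩
      dist u w                                   ≡⟨ dist-distinct (λ { refl → u∉W w∈W }) ⟩
      (if does (adj? u w) then 1 else 2)         ≡⟨ cong (if_then 1 else 2) same-adjacency ⟩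
      (if does (adj? v w) then 1 else 2)         ≡⟨ dist-distinct (λ { refl → v∉W w∈W }) ⟨
      dist v w                                   ≡⟨ isDist⇒≡dist dv-isDist ⟨
      dv                                         ∎)
    where open ≡-Reasoning

  resolving-bound : ∀ {W} → Resolving G W → ∀ {vs} → Unique vs → length vs ≤ 2 ^ length W + length W
  resolving-bound {W} resolving {vs} vs-unique = begin
    length vs                                       ≤⟨ length-outsideOf W vs-unique ⟩
    length (outsideOf W vs) + length W              ≡⟨ cong (_+ length W) (length-map (signature W) (outsideOf W vs)) ⟨
    length (map (signature W) (outsideOf W vs)) + length W
      ≤⟨ +-monoˡ-≤ (length W) (Counting.unique-⊆⇒length≤ signatures-unique (λ _ → ∈-allSubsets _)) ⟩
    length (allSubsets (length W)) + length W      ≡⟨ cong (_+ length W) (length-allSubsets (length W)) ⟩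
    2 ^ length W + length W                         ∎
    where
    open ≤-Reasoning
    signatures-unique : Unique (map (signature W) (outsideOf W vs))
    signatures-unique = Counting.unique-map (signature W) (outsideOf-unique W vs-unique)
      (λ u∈ v∈ → resolving⇒signature-injective resolving (outsideOf-∉ W {vs} u∈) (outsideOf-∉ W {vs} v∈))

  edist : V G → V G → V G → ℕ
  edist x y w = dist x w ⊓ dist y w

  isEdgeDist-edist : ∀ x y w → IsEdgeDist G x y w (edist x y w)
  isEdgeDist-edist x y w = dist x w , dist y w , isDist-dist x w , isDist-dist y w , refl

  isEdgeDist⇒≡edist : ∀ {x y w n} → IsEdgeDist G x y w n → n ≡ edist x y w
  isEdgeDist⇒≡edist (_ , _ , dx-isDist , dy-isDist , n≡) =
    trans n≡ (cong₂ _⊓_ (isDist⇒≡dist dx-isDist) (isDist⇒≡dist dy-isDist))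

  edist-endpoint : ∀ {x y w} → InPair x y w → edist x y w ≡ 0
  edist-endpoint {x} {y} (inj₁ refl) = cong (_⊓ dist y x) (dist-refl x)
  edist-endpoint {x} {y} (inj₂ refl) = trans (cong (dist x y ⊓_) (dist-refl y)) (⊓-zeroʳ (dist x y))

  edist-nonendpoint : ∀ {x y w} → ¬ InPair x y w → 1 ≤ edist x y w
  edist-nonendpoint w∉xy = ⊓-glb (dist-pos (w∉xy ∘ inj₁ ∘ sym)) (dist-pos (w∉xy ∘ inj₂ ∘ sym))

  separates⇒edist≢ : ∀ {x y x' y' w} → Separates x y x' y' w → edist x y w ≢ edist x' y' w
  separates⇒edist≢ (inj₁ (w∈xy , w∉x'y')) same =
    n≮0 (subst (1 ≤_) (trans (sym same) (edist-endpoint w∈xy)) (edist-nonendpoint w∉x'y'))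
  separates⇒edist≢ (inj₂ (w∈x'y' , w∉xy)) same =
    n≮0 (subst (1 ≤_) (trans same (edist-endpoint w∈x'y')) (edist-nonendpoint w∉xy))

  all-but-one-edge-resolving : ∀ (r : V G) {W} → (∀ w → w ≢ r → w ∈ₗ W) → EdgeResolving G W
  all-but-one-edge-resolving r covers x y x' y' x~y x'~y' different
    with separator-avoiding r (adj⇒≢ x~y) (adj⇒≢ x'~y') different
  ... | w , w≢r , separates =
    w , covers w w≢r , edist x y w , edist x' y' w ,
    isEdgeDist-edist x y w , isEdgeDist-edist x' y' w , separates⇒edist≢ separates

  Covers : V G → V G → Set
  Covers c p = Universal G c ⊎ Universal G p

  covers⇒adj : ∀ {c p} → c ≢ p → Covers c p → Adj G c p
  covers⇒adj c≢p (inj₁ c-universal) = c-universal _ (c≢p ∘ sym)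
  covers⇒adj c≢p (inj₂ p-universal)  = adj-sym (p-universal _ c≢p)

  edist-covered : ∀ {c p w} → Covers c p → ¬ InPair c p w → edist c p w ≡ 1
  edist-covered {c} {p} {w} (inj₁ c-universal) w∉cp =
    trans (cong (_⊓ dist p w) (dist-adj (c-universal w (w∉cp ∘ inj₁))))
          (m≤n⇒m⊓n≡m (dist-pos (w∉cp ∘ inj₂ ∘ sym)))
  edist-covered {c} {p} {w} (inj₂ p-universal) w∉cp =
    trans (cong (dist c w ⊓_) (dist-adj (p-universal w (w∉cp ∘ inj₂))))
          (m≥n⇒m⊓n≡n (dist-pos (w∉cp ∘ inj₁ ∘ sym)))

  -- Two vertices p, q outside an edge-resolving set W have no common
  -- neighbour c covering both cp and cq: only p and q could tell the
  -- edges cp and cq apart.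
  no-covering-neighbour : ∀ {W} → EdgeResolving G W → ∀ {c p q} →
    c ≢ p → c ≢ q → p ≢ q → Covers c p → Covers c q → p ∉ₗ W → q ∉ₗ W → ⊥
  no-covering-neighbour {W} resolving {c} {p} {q} c≢p c≢q p≢q cp-covered cq-covered p∉W q∉W
    with resolving c p c q (covers⇒adj c≢p cp-covered) (covers⇒adj c≢q cq-covered) different
    where
    different : ¬ SameEdge c p c q
    different (inj₁ (_ , p≡q))   = p≢q p≡q
    different (inj₂ (c≡q , p≡c)) = p≢q (trans p≡c c≡q)
  ... | w , w∈W , d , d' , d-isEdgeDist , d'-isEdgeDist , d≢d' = d≢d' (begin
    d            ≡⟨ isEdgeDist⇒≡edist d-isEdgeDist ⟩
    edist c p w  ≡⟨ same-edist ⟩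
    edist c q w  ≡⟨ isEdgeDist⇒≡edist d'-isEdgeDist ⟨
    d'           ∎)
    where
    open ≡-Reasoning
    w≢p : w ≢ p
    w≢p refl = p∉W w∈W
    w≢q : w ≢ q
    w≢q refl = q∉W w∈W
    same-edist : edist c p w ≡ edist c q w
    same-edist with w ≟ c
    ... | yes w≡c = trans (edist-endpoint (inj₁ w≡c)) (sym (edist-endpoint (inj₁ w≡c)))
    ... | no w≢c  = trans (edist-covered cp-covered [ w≢c , w≢p ])
                          (sym (edist-covered cq-covered [ w≢c , w≢q ]))

  -- With two universal vertices u₁, u₂ and a third vertex x, an edge-resolving
  -- set misses at most one vertex: every pair outside it has a covering
  -- common neighbour (u₁, u₂, or x when the pair is {u₁, u₂}).
  two-universal⇒missesAtMostOne : ∀ {W} → EdgeResolving G W →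
    ∀ {u₁ u₂ x} → Universal G u₁ → Universal G u₂ → u₁ ≢ u₂ → x ≢ u₁ → x ≢ u₂ →
    MissesAtMostOne W
  two-universal⇒missesAtMostOne {W} resolving {u₁} {u₂} {x} u₁-universal u₂-universal u₁≢u₂ x≢u₁ x≢u₂
    = outside-pair
    where
    impossible : ∀ {c p q} → c ≢ p → c ≢ q → p ≢ q → Covers c p → Covers c q → p ∉ₗ W → q ∉ₗ W → ⊥
    impossible = no-covering-neighbour resolving
    u₁-and : ∀ {q} → u₁ ≢ q → u₁ ∉ₗ W → q ∉ₗ W → ⊥
    u₁-and {q} u₁≢q u₁∉W q∉W with q ≟ u₂
    ... | yes refl = impossible x≢u₁ x≢u₂ u₁≢u₂ (inj₂ u₁-universal) (inj₂ u₂-universal) u₁∉W q∉W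
    ... | no q≢u₂  = impossible (u₁≢u₂ ∘ sym) (q≢u₂ ∘ sym) u₁≢q (inj₁ u₂-universal) (inj₁ u₂-universal) u₁∉W q∉W
    outside-pair : ∀ {p q} → p ≢ q → p ∉ₗ W → q ∉ₗ W → ⊥
    outside-pair {p} {q} p≢q p∉W q∉W with p ≟ u₁ | q ≟ u₁
    ... | yes refl | _ = u₁-and p≢q p∉W q∉W
    ... | _ | yes refl = u₁-and (p≢q ∘ sym) q∉W p∉W
    ... | no p≢u₁ | no q≢u₁ =
      impossible (p≢u₁ ∘ sym) (q≢u₁ ∘ sym) p≢q (inj₁ u₁-universal) (inj₁ u₁-universal) p∉W q∉W

-- n ↦ 2^n + n is strictly increasing, so a bound on its value bounds n.
exp+id-reflects : ∀ {k m} → suc (k + 2 ^ k) ≤ 2 ^ m + m → k + 1 ≤ m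
exp+id-reflects {k} {m} bound with m ≤? k
... | yes m≤k = contradiction bound (≤⇒≯ (begin
  2 ^ m + m ≤⟨ +-mono-≤ (^-monoʳ-≤ 2 m≤k) m≤k ⟩
  2 ^ k + k ≡⟨ +-comm (2 ^ k) k ⟩
  k + 2 ^ k ∎))
  where open ≤-Reasoning
... | no m≰k = subst (_≤ m) (+-comm 1 k) (≰⇒> m≰k)

module Hk (k : ℕ) where

  _≟V_ : DecidableEquality (HV k)
  t   ≟V t   = yes refl
  t   ≟V b _ = no λ ()
  t   ≟V a _ = no λ ()
  b _ ≟V t   = no λ ()
  b i ≟V b j with i ≟F j
  ... | yes refl = yes refl
  ... | no i≢j   = no λ { refl → i≢j refl }
  b _ ≟V a _ = no λ ()
  a _ ≟V t   = no λ ()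
  a _ ≟V b _ = no λ ()
  a S ≟V a T with ≡-dec _≟B_ S T
  ... | yes refl = yes refl
  ... | no S≢T   = no λ { refl → S≢T refl }

  adj? : ∀ u v → Dec (HAdj k u v)
  adj? t     t     = no λ ()
  adj? t     (b _) = yes tt
  adj? t     (a _) = yes tt
  adj? (b _) t     = yes tt
  adj? (a _) t     = yes tt
  adj? (b i) (b j) = ¬? (i ≟F j)
  adj? (a S) (a T) = ¬? (≡-dec _≟B_ S T)
  adj? (b i) (a S) = i ∈? S
  adj? (a S) (b i) = i ∈? S

  irrefl : ∀ {u} → ¬ HAdj k u u
  irrefl {t}   ()
  irrefl {b i} i≢i = i≢i refl
  irrefl {a S} S≢S = S≢S refl

  adj-sym : ∀ {u v} → HAdj k u v → HAdj k v u
  adj-sym {t}   {b _} _   = tt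
  adj-sym {t}   {a _} _   = tt
  adj-sym {b _} {t}   _   = tt
  adj-sym {a _} {t}   _   = tt
  adj-sym {b _} {b _} i≢j = i≢j ∘ sym
  adj-sym {a _} {a _} S≢T = S≢T ∘ sym
  adj-sym {b _} {a _} i∈S = i∈S
  adj-sym {a _} {b _} i∈S = i∈S

  t-universal : Universal (H k) t
  t-universal t     t≢t = ⊥-elim (t≢t refl)
  t-universal (b _) _   = tt
  t-universal (a _) _   = tt

  aB-universal : Universal (H k) (a ⊤)
  aB-universal t     _     = tt
  aB-universal (b _) _     = ∈⊤
  aB-universal (a S) S≢⊤ ⊤≡S = S≢⊤ (cong a (sym ⊤≡S))

  open DiameterTwo (H k) _≟V_ adj? irrefl adj-sym t t-universal
  open Outside _≟V_ using (missesAtMostOne-bound)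

  bs : List (HV k)
  bs = map b (allFin k)

  nonT : List (HV k)
  nonT = bs ++ map a (allSubsets k)

  vertices : List (HV k)
  vertices = t ∷ nonT

  b∈bs : ∀ i → b i ∈ₗ bs
  b∈bs i = ∈-map⁺ b (∈-allFin i)

  ∈-nonT : ∀ u → u ≢ t → u ∈ₗ nonT
  ∈-nonT t     t≢t = ⊥-elim (t≢t refl)
  ∈-nonT (b i) _   = ∈-++⁺ˡ (b∈bs i)
  ∈-nonT (a S) _   = ∈-++⁺ʳ bs (∈-map⁺ a (∈-allSubsets S))

  bs-unique : Unique bs
  bs-unique = Unique.map⁺ (λ { refl → refl }) (Unique.allFin⁺ k)

  nonT-unique : Unique nonT
  nonT-unique = Unique.++⁺ bs-unique (Unique.map⁺ (λ { refl → refl }) (allSubsets-unique k)) disjoint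
    where
    disjoint : ∀ {v} → ¬ (v ∈ₗ bs × v ∈ₗ map a (allSubsets k))
    disjoint (v∈bs , v∈as) with ∈-map⁻ b v∈bs | ∈-map⁻ a v∈as
    ... | _ , _ , refl | _ , _ , ()

  t∉nonT : t ∉ₗ nonT
  t∉nonT t∈ with ∈-++⁻ bs t∈
  ... | inj₁ t∈bs with ∈-map⁻ b t∈bs
  ...   | _ , _ , ()
  t∉nonT t∈ | inj₂ t∈as with ∈-map⁻ a t∈as
  ...   | _ , _ , ()

  t∷-unique : ∀ {vs} → (∀ {u} → u ∈ₗ vs → u ∈ₗ nonT) → Unique vs → Unique (t ∷ vs)
  t∷-unique vs⊆nonT vs-unique =
    All.tabulate (λ u∈vs t≡u → t∉nonT (vs⊆nonT (subst (_∈ₗ _) (sym t≡u) u∈vs))) ∷ vs-unique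

  vertices-unique : Unique vertices
  vertices-unique = t∷-unique id nonT-unique

  length-bs : length bs ≡ k
  length-bs = trans (length-map b (allFin k)) (length-tabulate id)

  length-nonT : length nonT ≡ k + 2 ^ k
  length-nonT = trans (length-++ bs)
    (cong₂ _+_ length-bs (trans (length-map a (allSubsets k)) (length-allSubsets k)))

  -- {t} ∪ B resolves H_k: t and the b_i are told apart by themselves, and
  -- a_S, a_T by some b_i with i in exactly one of S, T.
  tB : List (HV k)
  tB = t ∷ bs

  tB-unique : Unique tB
  tB-unique = t∷-unique ∈-++⁺ˡ bs-unique

  length-tB : length tB ≡ k + 1
  length-tB = trans (cong suc length-bs) (+-comm 1 k)

  a-distances : ∀ {i S T} → i ∈ S → i ∉ T → dist (a S) (b i) ≢ dist (a T) (b i)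
  a-distances i∈S i∉T same with trans (sym (dist-adj i∈S)) (trans same (dist-nonadj (λ ()) i∉T))
  ... | ()

  tB-resolving : Resolving (H k) tB
  tB-resolving t v t≢v = resolved-by (here refl) (dist-self-separates t≢v)
  tB-resolving u t u≢t = resolved-by (here refl) (dist-self-separates (u≢t ∘ sym) ∘ sym)
  tB-resolving (b i) v bi≢v = resolved-by (there (b∈bs i)) (dist-self-separates bi≢v)
  tB-resolving u (b j) u≢bj = resolved-by (there (b∈bs j)) (dist-self-separates (u≢bj ∘ sym) ∘ sym)
  tB-resolving (a S) (a T) aS≢aT with subset-difference (aS≢aT ∘ cong a)
  ... | i , inj₁ (i∈S , i∉T) = resolved-by (there (b∈bs i)) (a-distances i∈S i∉T)
  ... | i , inj₂ (i∈T , i∉S) = resolved-by (there (b∈bs i)) (a-distances i∈T i∉S ∘ sym)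

  length-vertices : length vertices ≡ suc (k + 2 ^ k)
  length-vertices = cong suc length-nonT

  metric-dimension : IsMetricDim (H k) (k + 1)
  metric-dimension = (tB , tB-unique , length-tB , tB-resolving) , lower
    where
    lower : ∀ W → Unique W → Resolving (H k) W → k + 1 ≤ length W
    lower W _ resolving = exp+id-reflects
      (subst (_≤ 2 ^ length W + length W) length-vertices (resolving-bound resolving vertices-unique))

  -- For k ≥ 1 the vertex b_i is a third vertex besides t and a_B.
  edge-metric-dimension : Fin k → IsEdgeMetricDim (H k) (k + 2 ^ k)
  edge-metric-dimension i =
    (nonT , nonT-unique , length-nonT , all-but-one-edge-resolving t ∈-nonT) , lower
    where
    lower : ∀ W → Unique W → EdgeResolving (H k) W → k + 2 ^ k ≤ length W
    lower W _ resolving = ≤-pred (subst (_≤ suc (length W)) length-vertices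
      (missesAtMostOne-bound W vertices-unique
        (two-universal⇒missesAtMostOne resolving {x = b i} t-universal aB-universal
          (λ ()) (λ ()) (λ ()))))

theorem3p9 : (k : ℕ) → 1 ≤ k →
    IsMetricDim (H k) (k + 1) × IsEdgeMetricDim (H k) (k + 2 ^ k)
-- k ≥ 1 provides the index zero : Fin k needed for the edge lower bound.
theorem3p9 (suc k) _ = Hk.metric-dimension (suc k) , Hk.edge-metric-dimension (suc k) zero
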